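{- Let $G^f$ be a graph having two false twins $u$ and $v$, and let $G^t$ be the graph obtained from $G^f$ by adding the edge $uv$. Then the set of co-2-plexes of $G^t$ equals the set of co-2-plexes of $G^f$.
   Context: Two vertices $u,v$ are false twins if $N(u)=N(v)$ and $uv$ is not an edge. A co-2-plex is a vertex set inducing a subgraph of maximum degree at most $1$. -}

module Defs where

open import Data.Nat using (ℕ; _≤_)
open import Data.Bool using (Bool; true; false; _∨_; _∧_)
open import Data.Product using (_×_)
open import Data.Empty using (⊥-elim)
open import Data.Fin using (Fin; _≟_)
open import Data.Fin.Subset using (Subset; _∈_; _∩_; ∣_∣)
open import Data.Vec using (tabulate)
open import Relation.Nullary using (¬_; yes; no)
open import Relation.Nullary.Decidable using (⌊_⌋)
open import Relation.Binary.PropositionalEquality using (_≡_; refl; cong₂)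

record Graph (n : ℕ) : Set where
  field
    adj    : Fin n → Fin n → Bool
    adj-sym    : ∀ x y → adj x y ≡ adj y x
    adj-irrefl : ∀ x → adj x x ≡ false
open Graph public

N : ∀ {n} → Graph n → Fin n → Subset n
N G x = tabulate (adj G x)

inducedDegree : ∀ {n} → Graph n → Subset n → Fin n → ℕ
inducedDegree G S x = ∣ N G x ∩ S ∣

IsCo2Plex : ∀ {n} → Graph n → Subset n → Set
IsCo2Plex G S = ∀ x → x ∈ S → inducedDegree G S x ≤ 1

FalseTwins : ∀ {n} → Graph n → Fin n → Fin n → Set
FalseTwins G u v = N G u ≡ N G v × adj G u v ≡ false

private
  isPair : ∀ {n} → Fin n → Fin n → Fin n → Fin n → Bool
  isPair u v x y = (⌊ x ≟ u ⌋ ∧ ⌊ y ≟ v ⌋) ∨ (⌊ x ≟ v ⌋ ∧ ⌊ y ≟ u ⌋)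

  isPair-sym : ∀ {n} (u v x y : Fin n) → isPair u v x y ≡ isPair u v y x
  isPair-sym u v x y with x ≟ u | y ≟ v | x ≟ v | y ≟ u
  ... | yes _ | yes _ | yes _ | yes _ = refl
  ... | yes _ | yes _ | yes _ | no  _ = refl
  ... | yes _ | yes _ | no  _ | yes _ = refl
  ... | yes _ | yes _ | no  _ | no  _ = refl
  ... | yes _ | no  _ | yes _ | yes _ = refl
  ... | yes _ | no  _ | yes _ | no  _ = refl
  ... | yes _ | no  _ | no  _ | yes _ = refl
  ... | yes _ | no  _ | no  _ | no  _ = refl
  ... | no  _ | yes _ | yes _ | yes _ = refl
  ... | no  _ | yes _ | yes _ | no  _ = refl
  ... | no  _ | yes _ | no  _ | yes _ = refl
  ... | no  _ | yes _ | no  _ | no  _ = refl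
  ... | no  _ | no  _ | yes _ | yes _ = refl
  ... | no  _ | no  _ | yes _ | no  _ = refl
  ... | no  _ | no  _ | no  _ | yes _ = refl
  ... | no  _ | no  _ | no  _ | no  _ = refl

  isPair-irrefl : ∀ {n} (u v x : Fin n) → ¬ u ≡ v → isPair u v x x ≡ false
  isPair-irrefl u v x u≢v with x ≟ u | x ≟ v
  ... | yes refl | yes refl = ⊥-elim (u≢v refl)
  ... | yes _ | no _ = refl
  ... | no _ | yes _ = refl
  ... | no _ | no _ = refl

addEdge : ∀ {n} → Graph n → (u v : Fin n) → ¬ u ≡ v → Graph n
adj (addEdge G u v _) x y = adj G x y ∨ isPair u v x y
adj-sym (addEdge G u v _) x y = cong₂ _∨_ (adj-sym G x y) (isPair-sym u v x y)
adj-irrefl (addEdge G u v u≢v) x = cong₂ _∨_ (adj-irrefl G x) (isPair-irrefl u v x u≢v)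

-- If u and v both lie in a
-- co-2-plex S of G, every common neighbour in S would be adjacent to two
-- distinct vertices of S; as u and v are twins, a neighbour of either is a
-- common neighbour, so u and v have no neighbours in S, and adding uv gives
-- each of them exactly one. Conversely, deleting an edge never creates a
-- vertex of higher degree.
module Submission where

open import Defs
open import Data.Bool using (true; false)
open import Data.Empty using (⊥-elim)
open import Data.Fin using (Fin; _≟_)
open import Data.Fin.Subset using (Subset; _∈_; _⊆_; _∩_; _-_; ∣_∣; ⁅_⁆)
open import Data.Fin.Subset.Properties
  using (x∈p∩q⁺; x∈p∩q⁻; nonempty?; Empty-unique; ∣⊥∣≡0; p⊆q⇒∣p∣≤∣q∣;
         ∣⁅x⁆∣≡1; x∈⁅y⁆⇔x≡y; x∈p∧x≢y⇒x∈p-y; x∈p⇒∣p-x∣<∣p∣)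
open import Data.Nat using (ℕ; _≤_; _<_; z≤n)
open import Data.Nat.Properties using (≤-trans; ≤-reflexive; ≤-pred; <-≤-trans; n≮0)
open import Data.Product using (_×_; _,_)
open import Data.Sum using (_⊎_; inj₁; inj₂)
open import Data.Vec using (lookup)
open import Data.Vec.Properties using (lookup∘tabulate; []=⇒lookup; lookup⇒[]=)
open import Function using (_∘_)
open import Function.Bundles using (_⇔_; mk⇔; Equivalence)
open import Relation.Nullary using (¬_; yes; no; contradiction)
open import Relation.Binary.PropositionalEquality using (_≡_; _≢_; refl; sym; trans; cong)
open Relation.Binary.PropositionalEquality.≡-Reasoning

private
  variable
    n : ℕ
    p : Subset n
    x y z u v w : Fin n

∣p∣≤1⇒members-equal : ∣ p ∣ ≤ 1 → x ∈ p → y ∈ p → x ≡ y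
∣p∣≤1⇒members-equal {p = p} {x = x} {y = y} ∣p∣≤1 x∈p y∈p with y ≟ x
... | yes y≡x = sym y≡x
... | no  y≢x = contradiction ∣p-x-y∣<0 n≮0
  where
  ∣p-x∣≤0 : ∣ p - x ∣ ≤ 0
  ∣p-x∣≤0 = ≤-pred (<-≤-trans (x∈p⇒∣p-x∣<∣p∣ x∈p) ∣p∣≤1)
  ∣p-x-y∣<0 : ∣ p - x - y ∣ < 0
  ∣p-x-y∣<0 = <-≤-trans (x∈p⇒∣p-x∣<∣p∣ (x∈p∧x≢y⇒x∈p-y y∈p y≢x)) ∣p-x∣≤0

members-equal⇒∣p∣≤1 : {p : Subset n} → (∀ {x y} → x ∈ p → y ∈ p → x ≡ y) → ∣ p ∣ ≤ 1
members-equal⇒∣p∣≤1 {n} {p} members-equal with nonempty? p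
... | no  empty = ≤-trans (≤-reflexive (trans (cong ∣_∣ (Empty-unique {p = p} empty)) (∣⊥∣≡0 n))) z≤n
... | yes (x , x∈p) = ≤-trans (p⊆q⇒∣p∣≤∣q∣ p⊆⁅x⁆) (≤-reflexive (∣⁅x⁆∣≡1 x))
  where
  p⊆⁅x⁆ : p ⊆ ⁅ x ⁆
  p⊆⁅x⁆ y∈p = Equivalence.from x∈⁅y⁆⇔x≡y (members-equal y∈p x∈p)

module _ (G : Graph n) where

  ∈N⇔adj : y ∈ N G x ⇔ adj G x y ≡ true
  ∈N⇔adj {y = y} {x = x} = mk⇔
    (λ y∈N → trans (sym (lookup∘tabulate (adj G x) y)) ([]=⇒lookup y∈N))
    (λ xy → lookup⇒[]= y _ (trans (lookup∘tabulate (adj G x) y) xy))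

  N≡N⇒adj≡adj : N G u ≡ N G v → ∀ w → adj G u w ≡ adj G v w
  N≡N⇒adj≡adj {u = u} {v = v} Nu≡Nv w = begin
    adj G u w             ≡⟨ sym (lookup∘tabulate (adj G u) w) ⟩
    lookup (N G u) w      ≡⟨ cong (λ s → lookup s w) Nu≡Nv ⟩
    lookup (N G v) w      ≡⟨ lookup∘tabulate (adj G v) w ⟩
    adj G v w             ∎

AtMostOneNeighbourIn : Graph n → Subset n → Set
AtMostOneNeighbourIn G S = ∀ {x y z} → x ∈ S → y ∈ S → z ∈ S
  → adj G x y ≡ true → adj G x z ≡ true → y ≡ z

module _ (G : Graph n) (S : Subset n) where

  IsCo2Plex⇔AtMostOneNeighbourIn : IsCo2Plex G S ⇔ AtMostOneNeighbourIn G S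
  IsCo2Plex⇔AtMostOneNeighbourIn = mk⇔ to from
    where
    neighbourIn : x ∈ S → adj G y x ≡ true → x ∈ N G y ∩ S
    neighbourIn x∈S yx = x∈p∩q⁺ (Equivalence.from (∈N⇔adj G) yx , x∈S)

    to : IsCo2Plex G S → AtMostOneNeighbourIn G S
    to co2 x∈S y∈S z∈S xy xz =
      ∣p∣≤1⇒members-equal (co2 _ x∈S) (neighbourIn y∈S xy) (neighbourIn z∈S xz)

    from : AtMostOneNeighbourIn G S → IsCo2Plex G S
    from unique x x∈S = members-equal⇒∣p∣≤1 λ y∈N∩S z∈N∩S →
      let y∈N , y∈S = x∈p∩q⁻ (N G x) S y∈N∩S
          z∈N , z∈S = x∈p∩q⁻ (N G x) S z∈N∩S
      in unique x∈S y∈S z∈S (Equivalence.to (∈N⇔adj G) y∈N) (Equivalence.to (∈N⇔adj G) z∈N)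

IsCo2Plex-antitone : (G H : Graph n) → (∀ x y → adj G x y ≡ true → adj H x y ≡ true)
  → (S : Subset n) → IsCo2Plex H S → IsCo2Plex G S
IsCo2Plex-antitone G H G⊆H S co2 x x∈S = ≤-trans (p⊆q⇒∣p∣≤∣q∣ N∩S-mono) (co2 x x∈S)
  where
  N∩S-mono : N G x ∩ S ⊆ N H x ∩ S
  N∩S-mono y∈N∩S with x∈p∩q⁻ (N G x) S y∈N∩S
  ... | y∈N , y∈S = x∈p∩q⁺ (Equivalence.from (∈N⇔adj H) (G⊆H x _ (Equivalence.to (∈N⇔adj G) y∈N)) , y∈S)

SamePair : Fin n → Fin n → Fin n → Fin n → Set
SamePair x y u v = (x ≡ u × y ≡ v) ⊎ (x ≡ v × y ≡ u)

SamePair-functional : u ≢ v → SamePair x y u v → SamePair x z u v → y ≡ z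
SamePair-functional u≢v (inj₁ (refl , refl)) (inj₁ (_ , refl))   = refl
SamePair-functional u≢v (inj₂ (refl , refl)) (inj₂ (_ , refl))   = refl
SamePair-functional u≢v (inj₁ (refl , _))    (inj₂ (x≡v , _))    = contradiction x≡v u≢v
SamePair-functional u≢v (inj₂ (refl , _))    (inj₁ (x≡u , _))    = contradiction (sym x≡u) u≢v

module _ (G : Graph n) (u v : Fin n) (u≢v : u ≢ v) where

  addEdge-adj⁺ : adj G x y ≡ true → adj (addEdge G u v u≢v) x y ≡ true
  addEdge-adj⁺ xy rewrite xy = refl

  addEdge-adj⁻ : adj (addEdge G u v u≢v) x y ≡ true → adj G x y ≡ true ⊎ SamePair x y u v
  addEdge-adj⁻ {x = x} {y = y} xy with adj G x y | x ≟ u | y ≟ v | x ≟ v | y ≟ u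
  ... | true  | _     | _     | _     | _     = inj₁ refl
  ... | false | yes a | yes b | _     | _     = inj₂ (inj₁ (a , b))
  ... | false | yes _ | no  _ | yes c | yes d = inj₂ (inj₂ (c , d))
  ... | false | no  _ | _     | yes c | yes d = inj₂ (inj₂ (c , d))
  addEdge-adj⁻ () | false | yes _ | no _ | yes _ | no _
  addEdge-adj⁻ () | false | yes _ | no _ | no  _ | _
  addEdge-adj⁻ () | false | no  _ | _    | yes _ | no _
  addEdge-adj⁻ () | false | no  _ | _    | no  _ | _

module _ (G : Graph n) (S : Subset n) (unique : AtMostOneNeighbourIn G S) where

  twin-has-no-neighbour-in : u ≢ v → (∀ w → adj G u w ≡ adj G v w)
    → u ∈ S → v ∈ S → w ∈ S → adj G u w ≢ true
  twin-has-no-neighbour-in {u = u} {v = v} {w = w} u≢v twin u∈S v∈S w∈S uw =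
    u≢v (unique w∈S u∈S v∈S wu wv)
    where
    wu : adj G w u ≡ true
    wu = trans (adj-sym G w u) uw
    wv : adj G w v ≡ true
    wv = trans (adj-sym G w v) (trans (sym (twin w)) uw)

  twins-have-no-neighbour-in : u ≢ v → (∀ w → adj G u w ≡ adj G v w)
    → SamePair x y u v → x ∈ S → y ∈ S → z ∈ S → adj G x z ≢ true
  twins-have-no-neighbour-in u≢v twin (inj₁ (refl , refl)) x∈S y∈S =
    twin-has-no-neighbour-in u≢v twin x∈S y∈S
  twins-have-no-neighbour-in u≢v twin (inj₂ (refl , refl)) x∈S y∈S =
    twin-has-no-neighbour-in (u≢v ∘ sym) (sym ∘ twin) x∈S y∈S

  addEdge-twins-AtMostOneNeighbourIn : (u≢v : u ≢ v) → (∀ w → adj G u w ≡ adj G v w)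
    → AtMostOneNeighbourIn (addEdge G u v u≢v) S
  addEdge-twins-AtMostOneNeighbourIn {u = u} {v = v} u≢v twin x∈S y∈S z∈S xy xz
    with addEdge-adj⁻ G u v u≢v xy | addEdge-adj⁻ G u v u≢v xz
  ... | inj₁ xy′ | inj₁ xz′ = unique x∈S y∈S z∈S xy′ xz′
  ... | inj₁ xy′ | inj₂ xz″ = ⊥-elim (twins-have-no-neighbour-in u≢v twin xz″ x∈S z∈S y∈S xy′)
  ... | inj₂ xy″ | inj₁ xz′ = ⊥-elim (twins-have-no-neighbour-in u≢v twin xy″ x∈S y∈S z∈S xz′)
  ... | inj₂ xy″ | inj₂ xz″ = SamePair-functional u≢v xy″ xz″

proposition1 : ∀ {n} (Gf : Graph n) (u v : Fin n) (u≢v : ¬ u ≡ v)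
    → FalseTwins Gf u v
    → ∀ (S : Subset n) → IsCo2Plex (addEdge Gf u v u≢v) S ⇔ IsCo2Plex Gf S
proposition1 Gf u v u≢v (Nu≡Nv , _) S = mk⇔
  (IsCo2Plex-antitone Gf Gt (λ _ _ → addEdge-adj⁺ Gf u v u≢v) S)
  (λ co2 → Equivalence.from (IsCo2Plex⇔AtMostOneNeighbourIn Gt S)
     (addEdge-twins-AtMostOneNeighbourIn Gf S
        (Equivalence.to (IsCo2Plex⇔AtMostOneNeighbourIn Gf S) co2)
        u≢v (N≡N⇒adj≡adj Gf Nu≡Nv)))
  where
  Gt : Graph _
  Gt = addEdge Gf u v u≢v
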